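{- For a complete multipartite graph $G$ with $\lambda\in\{0,1\}$, $\mathrm{nim}(\mathrm{DNG}(G))=1-\mathrm{pty}(V)$ and $\mathrm{nim}(\mathrm{GEN}(G))=\mathrm{pty}(V)$.
   Context: $G=K_{m_1,\ldots,m_k}$ is a complete multipartite graph with $k\ge 2$ parts and $m_1\le\cdots\le m_k$; $\lambda:=|\{i\mid m_i\ge 2\}|$ is the number of parts with at least two vertices. For a graph $G=(V,E)$, a set of vertices is geodetically convex if it contains every vertex on every shortest path between two of its vertices; the convex hull $[P]$ is the smallest convex set containing $P$, and $P$ is generating if $[P]=V$. In the achievement game $\mathrm{GEN}(G)$, two players alternately select previously-unselected vertices; the game ends as soon as the selected set generates, and the last player to move wins. In the avoidance game $\mathrm{DNG}(G)$, players alternately select previously-unselected vertices such that the selected set never generates; the player who cannot move loses. $\mathrm{nim}$ denotes the nim-number of an impartial game, and $\mathrm{pty}(V):=|V|\bmod 2$. -}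

module Defs where

open import Data.Nat using (ℕ; zero; suc; _≤_; _<_; _≤?_)
open import Data.Fin using (Fin)
open import Data.Fin.Properties using () renaming (_≟_ to _≟ᶠ_)
open import Data.Fin.Subset using (Subset; _∈_; _∉_; _⊆_; _∪_; ⁅_⁆; ∣_∣)
open import Data.Vec using (tabulate)
open import Data.List using (List; length; filter)
open import Data.List using () renaming (allFin to allFinL)
open import Data.Bool using (Bool; true; false)
open import Data.Product using (Σ; _×_; ∃)
open import Relation.Nullary using (¬_; Dec; yes; no)
open import Relation.Binary.PropositionalEquality using (_≡_; _≢_)

-- Complete multipartite graph on vertex set Fin n, given by a part map
-- p : Fin n → Fin k (vertex v lies in part p v). Two vertices are
-- adjacent iff they lie in different parts.

module CMG {n k : ℕ} (p : Fin n → Fin k) where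

  Adj : Fin n → Fin n → Set
  Adj u v = p u ≢ p v

  partSize : Fin k → ℕ
  partSize i = ∣ tabulate (λ v → isIn v) ∣
    where
    isIn : Fin n → Bool
    isIn v with p v ≟ᶠ i
    ... | yes _ = true
    ... | no  _ = false

  lam : ℕ
  lam = length (filter (λ i → 2 ≤? partSize i) (allFinL k))

  data Walk : Fin n → Fin n → Set where
    here : ∀ {u} → Walk u u
    step : ∀ {u w v} → Adj u w → Walk w v → Walk u v

  walkLength : ∀ {u v} → Walk u v → ℕ
  walkLength here       = zero
  walkLength (step _ w) = suc (walkLength w)

  data OnWalk (x : Fin n) : ∀ {u v} → Walk u v → Set where
    onHere : ∀ {v} {w : Walk x v} → OnWalk x w
    onStep : ∀ {u w v} {a : Adj u w} {ws : Walk w v} → OnWalk x ws → OnWalk x (step a ws)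

  Shortest : ∀ {u v} → Walk u v → Set
  Shortest {u} {v} w = (w' : Walk u v) → walkLength w ≤ walkLength w'

  Convex : Subset n → Set
  Convex S = ∀ u v → u ∈ S → v ∈ S → (w : Walk u v) → Shortest w →
             ∀ x → OnWalk x w → x ∈ S

  -- P generates: its convex hull (the smallest convex superset, i.e. the
  -- intersection of all convex supersets) is all of V
  Generating : Subset n → Set
  Generating P = ∀ S → P ⊆ S → Convex S → ∀ x → x ∈ S

  MoveGEN : Subset n → Subset n → Set
  MoveGEN P Q = ¬ Generating P × Σ (Fin n) (λ v → v ∉ P × Q ≡ P ∪ ⁅ v ⁆)

  MoveDNG : Subset n → Subset n → Set
  MoveDNG P Q = Σ (Fin n) (λ v → v ∉ P × Q ≡ P ∪ ⁅ v ⁆ × ¬ Generating Q)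

-- Nim-number of a position in a finite impartial game (normal play) with
-- positions Subset n and move relation Move. NimIs Move f P g says that the
-- nim-number of P is g, where f bounds the remaining number of moves
-- (every move selects a new vertex, so f = n - |P| suffices).
-- nim(P) = mex { nim(Q) | Q an option of P }.

NimIs : {n : ℕ} → (Subset n → Subset n → Set) → ℕ → Subset n → ℕ → Set
NimIs Move zero    P g = (∀ Q → ¬ Move P Q) × g ≡ 0
NimIs Move (suc f) P g =
  (∀ Q → Move P Q → ∃ λ h → NimIs Move f Q h × h ≢ g) ×
  (∀ h → h < g → ∃ λ Q → Move P Q × NimIs Move f Q h)

{-# OPTIONS --safe #-}
-- With at most one part of size at least two, a vertex is interior to a geodesic only if
-- it lies outside that part, between two of its vertices. Hence a set generates exactly
-- when it contains the set R of required vertices (the big part, or every vertex if there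
-- is none), and |R| ≥ 2. Both games then depend only on the numbers a and b of unselected
-- vertices inside and outside R: GEN has nim-value (a + b) mod 2 while a ≥ 2 (and
-- 1 + b mod 2 once a = 1), and DNG, in which the last vertex of R can never be taken, has
-- nim-value (a + b - 1) mod 2.
module Submission where

open import Defs
open import Data.Nat using (ℕ; _≤_; _∸_; _%_)
open import Data.Fin using (Fin) renaming (_≤_ to _≤ᶠ_)
open import Data.Fin.Subset using (⊥)
open import Data.Product using (_×_; ∃)
open import Relation.Binary.PropositionalEquality using (_≡_)

open import Data.Bool using (Bool; true)
open import Data.Nat using (zero; suc; _+_; _<_; z≤n; s≤s; z<s; _≤?_)
open import Data.Nat.Properties
  using (0≢1+n; 1+n≢n; +-suc; m≤n⇒m≤1+n; ≤-trans; <-irrefl; m+[n∸m]≡n; suc-injective)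
open import Data.Fin using () renaming (zero to fzero; suc to fsuc)
open import Data.Fin.Properties using (_≟_; any?)
open import Data.Fin.Subset
  using (Subset; inside; outside; _∈_; _∉_; _⊆_; _∪_; _─_; _-_; ⁅_⁆; ∁; ∣_∣; Nonempty)
open import Data.Fin.Subset.Properties
  using (_∈?_; nonempty?; Empty-unique; ∣⊥∣≡0; ∣p∣≤n; ∣∁p∣≡n∸∣p∣; p─⊥≡p; p─q─r≡p─q∪r; p─q⊆p;
         x∈p∧x∉q⇒x∈p─q; x∈p∧x≢y⇒x∈p-y; ⊆-antisym; x∈⁅x⁆; x∈⁅y⁆⇒x≡y; x∉⁅y⁆⇒x≢y;
         x∈p⇒x∉∁p; x∈∁p⇒x∉p; x∉p⇒x∈∁p)
open import Data.Vec using (_∷_; tabulate; here; there)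
open import Data.Vec.Properties using (lookup∘tabulate; lookup⇒[]=; []=⇒lookup)
open import Data.List using (List; length; filter) renaming (allFin to allFinL)
open import Data.List.Membership.Propositional using () renaming (_∈_ to _∈ˡ_)
open import Data.List.Membership.Propositional.Properties using (∈-filter⁺; ∈-allFin)
open import Data.List.Relation.Unary.Any using (here; there)
open import Data.Product using (Σ; ∃₂; _,_; proj₁)
open import Function using (_∘_)
open import Relation.Nullary using (¬_; Dec; yes; no; does; contradiction; ¬?)
open import Relation.Nullary.Decidable using (_×-dec_; dec-true; decidable-stable)
open import Relation.Binary.PropositionalEquality using (_≢_; refl; sym; trans; cong; subst; ≢-sym)

suc%2≢%2 : ∀ m → suc m % 2 ≢ m % 2
suc%2≢%2 zero ()
suc%2≢%2 (suc zero) ()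
suc%2≢%2 (suc (suc m)) = suc%2≢%2 m

suc%2≡1⇒%2≡0 : ∀ m → suc m % 2 ≡ 1 → m % 2 ≡ 0
suc%2≡1⇒%2≡0 zero _ = refl
suc%2≡1⇒%2≡0 (suc zero) ()
suc%2≡1⇒%2≡0 (suc (suc m)) = suc%2≡1⇒%2≡0 m

1∸suc%2 : ∀ m → 1 ∸ suc m % 2 ≡ m % 2
1∸suc%2 zero = refl
1∸suc%2 (suc zero) = refl
1∸suc%2 (suc (suc m)) = 1∸suc%2 m

0<%2⇒%2≡1 : ∀ m → 0 < m % 2 → m % 2 ≡ 1
0<%2⇒%2≡1 (suc zero) _ = refl
0<%2⇒%2≡1 (suc (suc m)) = 0<%2⇒%2≡1 m

1+h≮%2 : ∀ m {h} → ¬ (suc h < m % 2)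
1+h≮%2 (suc zero) (s≤s ())
1+h≮%2 (suc (suc m)) = 1+h≮%2 m

+suc%2≢ : ∀ a b → (a + b) % 2 ≢ (a + suc b) % 2
+suc%2≢ a b e = suc%2≢%2 (a + b) (trans (cong (_% 2) (sym (+-suc a b))) (sym e))

+suc%2≡1⇒%2≡0 : ∀ a b → (a + suc b) % 2 ≡ 1 → (a + b) % 2 ≡ 0
+suc%2≡1⇒%2≡0 a b odd = suc%2≡1⇒%2≡0 (a + b) (trans (cong (_% 2) (sym (+-suc a b))) odd)

1≤length : ∀ {A : Set} {x : A} {xs : List A} → x ∈ˡ xs → 1 ≤ length xs
1≤length (here _) = z<s
1≤length (there _) = z<s

2≤length : ∀ {A : Set} {x y : A} {xs : List A} → x ∈ˡ xs → y ∈ˡ xs → x ≢ y → 2 ≤ length xs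
2≤length (here refl) (here refl) x≢y = contradiction refl x≢y
2≤length (here _) (there y∈xs) _ = s≤s (1≤length y∈xs)
2≤length (there x∈xs) (here _) _ = s≤s (1≤length x∈xs)
2≤length (there x∈xs) (there y∈xs) x≢y = m≤n⇒m≤1+n (2≤length x∈xs y∈xs x≢y)

module _ {n : ℕ} where

  ∈-tabulate⁺ : ∀ (f : Fin n → Bool) {x} → f x ≡ true → x ∈ tabulate f
  ∈-tabulate⁺ f {x} fx≡true = lookup⇒[]= x (tabulate f) (trans (lookup∘tabulate f x) fx≡true)

  ∈-tabulate⁻ : ∀ (f : Fin n → Bool) {x} → x ∈ tabulate f → f x ≡ true
  ∈-tabulate⁻ f {x} x∈ = trans (sym (lookup∘tabulate f x)) ([]=⇒lookup x∈)

∣p∣≡1+∣p-x∣ : ∀ {n} {p : Subset n} {x} → x ∈ p → ∣ p ∣ ≡ suc ∣ p - x ∣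
∣p∣≡1+∣p-x∣ {p = inside ∷ p} here = cong suc (cong ∣_∣ (sym (p─⊥≡p p)))
∣p∣≡1+∣p-x∣ {p = inside ∷ _} (there x∈p) = cong suc (∣p∣≡1+∣p-x∣ x∈p)
∣p∣≡1+∣p-x∣ {p = outside ∷ _} (there x∈p) = ∣p∣≡1+∣p-x∣ x∈p

module _ {n : ℕ} {p : Subset n} where

  2≤∣p∣ : ∀ {x y} → x ∈ p → y ∈ p → x ≢ y → 2 ≤ ∣ p ∣
  2≤∣p∣ x∈p y∈p x≢y
    rewrite ∣p∣≡1+∣p-x∣ x∈p | ∣p∣≡1+∣p-x∣ (x∈p∧x≢y⇒x∈p-y y∈p (≢-sym x≢y)) = s≤s z<s

  x∉p⇒p-x≡p : ∀ {x} → x ∉ p → p - x ≡ p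
  x∉p⇒p-x≡p x∉p = ⊆-antisym (p─q⊆p p ⁅ _ ⁆) λ y∈p → x∈p∧x≢y⇒x∈p-y y∈p λ { refl → x∉p y∈p }

  0<∣p∣⇒nonempty : 0 < ∣ p ∣ → Nonempty p
  0<∣p∣⇒nonempty 0<∣p∣ = decidable-stable (nonempty? p) λ empty →
    <-irrefl (sym (trans (cong ∣_∣ (Empty-unique empty)) (∣⊥∣≡0 n))) 0<∣p∣

  ∣p∣+∣∁p∣≡n : ∣ p ∣ + ∣ ∁ p ∣ ≡ n
  ∣p∣+∣∁p∣≡n = trans (cong (∣ p ∣ +_) (∣∁p∣≡n∸∣p∣ p)) (m+[n∸m]≡n (∣p∣≤n p))

x∈p─q⇒x∉q : ∀ {n} {p q : Subset n} {x} → x ∈ p ─ q → x ∉ q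
x∈p─q⇒x∉q {p = _ ∷ _} () here
x∈p─q⇒x∉q {p = _ ∷ _} (there x∈p─q) (there x∈q) = x∈p─q⇒x∉q x∈p─q x∈q

module _ {n : ℕ} {p q : Subset n} where

  0<∣p─q∣⇒∃x∈p∉q : 0 < ∣ p ─ q ∣ → ∃ λ x → x ∈ p × x ∉ q
  0<∣p─q∣⇒∃x∈p∉q 0<∣p─q∣ =
    let x , x∈p─q = 0<∣p∣⇒nonempty 0<∣p─q∣ in x , p─q⊆p p q x∈p─q , x∈p─q⇒x∉q x∈p─q

  ∣p─q∣≡0⇒p⊆q : ∣ p ─ q ∣ ≡ 0 → p ⊆ q
  ∣p─q∣≡0⇒p⊆q ∣p─q∣≡0 {x} x∈p with x ∈? q
  ... | yes x∈q = x∈q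
  ... | no x∉q = contradiction (trans (sym ∣p─q∣≡0) (∣p∣≡1+∣p-x∣ (x∈p∧x∉q⇒x∈p─q x∈p x∉q))) 0≢1+n

  ∣p─q∣≡1+∣p─q∪⁅x⁆∣ : ∀ {x} → x ∈ p → x ∉ q → ∣ p ─ q ∣ ≡ suc ∣ p ─ (q ∪ ⁅ x ⁆) ∣
  ∣p─q∣≡1+∣p─q∪⁅x⁆∣ {x} x∈p x∉q =
    trans (∣p∣≡1+∣p-x∣ (x∈p∧x∉q⇒x∈p─q x∈p x∉q)) (cong (suc ∘ ∣_∣) (p─q─r≡p─q∪r p q ⁅ x ⁆))

  ∣p─q∪⁅x⁆∣≡∣p─q∣ : ∀ {x} → x ∉ p → ∣ p ─ (q ∪ ⁅ x ⁆) ∣ ≡ ∣ p ─ q ∣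
  ∣p─q∪⁅x⁆∣≡∣p─q∣ {x} x∉p =
    cong ∣_∣ (trans (sym (p─q─r≡p─q∪r p q ⁅ x ⁆)) (x∉p⇒p-x≡p (x∉p ∘ p─q⊆p p q)))

-- Games whose generating sets are the supersets of a fixed set

NimIs-+-suc : ∀ {n} (Move : Subset n → Subset n → Set) a b P g →
              NimIs Move (suc a + b) P g → NimIs Move (a + suc b) P g
NimIs-+-suc Move a b P g = subst (λ f → NimIs Move f P g) (sym (+-suc a b))

genNim : ℕ → ℕ → ℕ
genNim zero b = 0
genNim (suc zero) b = suc (b % 2)
genNim (suc (suc a)) b = (a + b) % 2

genNim-target : ∀ a b → genNim a b ≢ genNim (suc a) b
genNim-target zero b ()
genNim-target (suc zero) b = 1+n≢n
genNim-target (suc (suc a)) b = suc%2≢%2 (a + b) ∘ sym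

genNim-other : ∀ a b → genNim (suc a) b ≢ genNim (suc a) (suc b)
genNim-other zero b = suc%2≢%2 b ∘ sym ∘ suc-injective
genNim-other (suc a) b = +suc%2≢ a b

module TargetGame {n : ℕ} (Gen : Subset n → Set) (R : Subset n)
                  (R⊆⇒gen : ∀ {P} → R ⊆ P → Gen P) (gen⇒R⊆ : ∀ {P} → Gen P → R ⊆ P) where

  -- Copies of CMG.MoveGEN and CMG.MoveDNG with Generating abstracted to Gen, so that
  -- they coincide definitionally with the graph games.
  MoveGEN : Subset n → Subset n → Set
  MoveGEN P Q = ¬ Gen P × Σ (Fin n) (λ v → v ∉ P × Q ≡ P ∪ ⁅ v ⁆)

  MoveDNG : Subset n → Subset n → Set
  MoveDNG P Q = Σ (Fin n) (λ v → v ∉ P × Q ≡ P ∪ ⁅ v ⁆ × ¬ Gen Q)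

  Counts : Subset n → ℕ → ℕ → Set
  Counts P a b = ∣ R ─ P ∣ ≡ a × ∣ ∁ R ─ P ∣ ≡ b

  data Added (P : Subset n) (x : Fin n) : ℕ → ℕ → Set where
    target : ∀ {a b} → x ∈ R → Counts (P ∪ ⁅ x ⁆) a b → Added P x (suc a) b
    other  : ∀ {a b} → x ∉ R → Counts (P ∪ ⁅ x ⁆) a b → Added P x a (suc b)

  added : ∀ {P x a b} → x ∉ P → Counts P a b → Added P x a b
  added {P} {x} x∉P (refl , refl) with x ∈? R
  ... | yes x∈R = subst (λ a → Added P x a ∣ ∁ R ─ P ∣) (sym (∣p─q∣≡1+∣p─q∪⁅x⁆∣ x∈R x∉P))
                    (target x∈R (refl , ∣p─q∪⁅x⁆∣≡∣p─q∣ {p = ∁ R} (x∈p⇒x∉∁p x∈R)))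
  ... | no x∉R = subst (Added P x ∣ R ─ P ∣) (sym (∣p─q∣≡1+∣p─q∪⁅x⁆∣ (x∉p⇒x∈∁p x∉R) x∉P))
                   (other x∉R (∣p─q∪⁅x⁆∣≡∣p─q∣ {p = R} x∉R , refl))

  unselected-target : ∀ {P a b} → Counts P (suc a) b → ∃ λ x → x ∈ R × x ∉ P
  unselected-target {P} (∣R─P∣≡1+a , _) =
    0<∣p─q∣⇒∃x∈p∉q {p = R} {P} (subst (0 <_) (sym ∣R─P∣≡1+a) z<s)

  unselected-other : ∀ {P a b} → Counts P a (suc b) → ∃ λ x → x ∈ ∁ R × x ∉ P
  unselected-other {P} (_ , ∣∁R─P∣≡1+b) =
    0<∣p─q∣⇒∃x∈p∉q {p = ∁ R} {P} (subst (0 <_) (sym ∣∁R─P∣≡1+b) z<s)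

  pick-target : ∀ {P a b} → Counts P (suc a) b → ∃ λ x → x ∉ P × Counts (P ∪ ⁅ x ⁆) a b
  pick-target c with unselected-target c
  ... | x , x∈R , x∉P with added x∉P c
  ...   | target _ c′ = x , x∉P , c′
  ...   | other x∉R _ = contradiction x∈R x∉R

  pick-other : ∀ {P a b} → Counts P a (suc b) → ∃ λ x → x ∉ P × Counts (P ∪ ⁅ x ⁆) a b
  pick-other c with unselected-other c
  ... | x , x∈∁R , x∉P with added x∉P c
  ...   | target x∈R _ = contradiction x∈R (x∈∁p⇒x∉p x∈∁R)
  ...   | other _ c′ = x , x∉P , c′

  counts⇒gen : ∀ {P b} → Counts P 0 b → Gen P
  counts⇒gen (∣R─P∣≡0 , _) = R⊆⇒gen (∣p─q∣≡0⇒p⊆q ∣R─P∣≡0)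

  counts⇒¬gen : ∀ {P a b} → Counts P (suc a) b → ¬ Gen P
  counts⇒¬gen c gen = let _ , x∈R , x∉P = unselected-target c in x∉P (gen⇒R⊆ gen x∈R)

  gen-move : ∀ {P a b x} → Counts P (suc a) b → x ∉ P → MoveGEN P (P ∪ ⁅ x ⁆)
  gen-move c x∉P = counts⇒¬gen c , _ , x∉P , refl

  dng-move : ∀ {P a b x} → x ∉ P → Counts (P ∪ ⁅ x ⁆) (suc a) b → MoveDNG P (P ∪ ⁅ x ⁆)
  dng-move x∉P c = _ , x∉P , refl , counts⇒¬gen c

  mutual
    gen-nim : ∀ {P a b} → Counts P a b → NimIs MoveGEN (a + b) P (genNim a b)
    gen-nim {a = zero} {zero} c = (λ _ (¬gen , _) → ¬gen (counts⇒gen c)) , refl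
    gen-nim {a = zero} {suc b} c = (λ _ (¬gen , _) → contradiction (counts⇒gen c) ¬gen) , λ _ ()
    gen-nim {a = suc a} c = gen-options c , gen-mex c

    gen-options : ∀ {P a b} → Counts P (suc a) b → ∀ Q → MoveGEN P Q →
                  ∃ λ h → NimIs MoveGEN (a + b) Q h × h ≢ genNim (suc a) b
    gen-options {P} {a} {b} c _ (_ , x , x∉P , refl) with added x∉P c
    ... | target _ c′ = _ , gen-nim c′ , genNim-target a b
    ... | other {b = b′} _ c′ =
      _ , NimIs-+-suc MoveGEN a b′ (P ∪ ⁅ x ⁆) _ (gen-nim c′) , genNim-other a b′

    gen-mex : ∀ {P a b} → Counts P (suc a) b → ∀ h → h < genNim (suc a) b →
              ∃ λ Q → MoveGEN P Q × NimIs MoveGEN (a + b) Q h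
    gen-mex {a = zero} c zero _ =
      let x , x∉P , c′ = pick-target c in _ , gen-move c x∉P , gen-nim c′
    gen-mex {P} {zero} {suc b} c 1 (s≤s 0<b%2) =
      let x , x∉P , c′ = pick-other c in
      _ , gen-move c x∉P ,
      subst (NimIs MoveGEN (suc b) (P ∪ ⁅ x ⁆))
        (cong suc (suc%2≡1⇒%2≡0 b (0<%2⇒%2≡1 (suc b) 0<b%2))) (gen-nim c′)
    gen-mex {P} {suc a} {suc b} c zero 0<%2 =
      let x , x∉P , c′ = pick-other c in
      _ , gen-move c x∉P ,
      subst (NimIs MoveGEN (suc a + suc b) (P ∪ ⁅ x ⁆))
        (+suc%2≡1⇒%2≡0 a b (0<%2⇒%2≡1 (a + suc b) 0<%2))
        (NimIs-+-suc MoveGEN (suc a) b (P ∪ ⁅ x ⁆) _ (gen-nim c′))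
    gen-mex {P} {suc (suc a)} {zero} c zero 0<%2 =
      let x , x∉P , c′ = pick-target c in
      _ , gen-move c x∉P ,
      subst (NimIs MoveGEN (suc (suc a) + 0) (P ∪ ⁅ x ⁆))
        (suc%2≡1⇒%2≡0 (a + 0) (0<%2⇒%2≡1 (suc a + 0) 0<%2)) (gen-nim c′)
    gen-mex {a = zero} {b} c (suc (suc h)) (s≤s h<b%2) = contradiction h<b%2 (1+h≮%2 b)
    gen-mex {a = suc a} {b} c (suc h) h< = contradiction h< (1+h≮%2 (a + b))

  mutual
    dng-nim : ∀ {P a b} → Counts P (suc a) b → NimIs MoveDNG (suc a + b) P ((a + b) % 2)
    dng-nim c = dng-options c , dng-mex c

    dng-options : ∀ {P a b} → Counts P (suc a) b → ∀ Q → MoveDNG P Q →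
                  ∃ λ h → NimIs MoveDNG (a + b) Q h × h ≢ (a + b) % 2
    dng-options {P} {a} {b} c _ (x , x∉P , refl , ¬gen) with added x∉P c
    ... | target {a = zero} _ c′ = contradiction (counts⇒gen c′) ¬gen
    ... | target {a = suc a′} _ c′ = _ , dng-nim c′ , suc%2≢%2 (a′ + b) ∘ sym
    ... | other {b = b′} _ c′ =
      _ , NimIs-+-suc MoveDNG a b′ (P ∪ ⁅ x ⁆) _ (dng-nim c′) , +suc%2≢ a b′

    dng-mex : ∀ {P a b} → Counts P (suc a) b → ∀ h → h < (a + b) % 2 →
              ∃ λ Q → MoveDNG P Q × NimIs MoveDNG (a + b) Q h
    dng-mex {P} {a} {suc b} c zero 0<%2 =
      let x , x∉P , c′ = pick-other c in
      _ , dng-move x∉P c′ ,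
      subst (NimIs MoveDNG (a + suc b) (P ∪ ⁅ x ⁆)) (+suc%2≡1⇒%2≡0 a b (0<%2⇒%2≡1 (a + suc b) 0<%2))
        (NimIs-+-suc MoveDNG a b (P ∪ ⁅ x ⁆) _ (dng-nim c′))
    dng-mex {P} {suc a} {zero} c zero 0<%2 =
      let x , x∉P , c′ = pick-target c in
      _ , dng-move x∉P c′ ,
      subst (NimIs MoveDNG (suc a + 0) (P ∪ ⁅ x ⁆))
        (suc%2≡1⇒%2≡0 (a + 0) (0<%2⇒%2≡1 (suc a + 0) 0<%2)) (dng-nim c′)
    dng-mex {a = a} {b} c (suc h) h< = contradiction h< (1+h≮%2 (a + b))

  nim-values : ∀ {P a b} → Counts P a b → 2 ≤ a →
               NimIs MoveDNG (a + b) P (1 ∸ (a + b) % 2) × NimIs MoveGEN (a + b) P ((a + b) % 2)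
  nim-values {a = suc zero} _ (s≤s ())
  nim-values {P} {suc (suc a)} {b} c _ =
    subst (NimIs MoveDNG (suc (suc a) + b) P) (sym (1∸suc%2 (suc a + b))) (dng-nim c) , gen-nim c

-- Complete multipartite graphs

module CompleteMultipartite {n k : ℕ} (p : Fin n → Fin k) where

  open CMG p hiding (MoveGEN; MoveDNG)

  Twins : Fin n → Fin n → Set
  Twins u w = u ≢ w × p u ≡ p w

  twins-sym : ∀ {u w} → Twins u w → Twins w u
  twins-sym (u≢w , pu≡pw) = ≢-sym u≢w , sym pu≡pw

  twins-distance : ∀ {u w} → Twins u w → (walk : Walk u w) → 2 ≤ walkLength walk
  twins-distance (u≢w , _) here = contradiction refl u≢w
  twins-distance (_ , pu≡pw) (step u~w here) = contradiction pu≡pw u~w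
  twins-distance _ (step _ (step _ _)) = s≤s (s≤s z≤n)

  detour : ∀ {u w y} → Adj u y → p u ≡ p w → Walk u w
  detour u~y pu≡pw = step u~y (step (λ py≡pw → u~y (trans pu≡pw (sym py≡pw))) here)

  first-neighbour : ∀ {u w} → u ≢ w → Walk u w → ∃ λ y → Adj u y
  first-neighbour u≢w here = contradiction refl u≢w
  first-neighbour _ (step u~y _) = _ , u~y

  interior⇒2≤length : ∀ {u w x} (walk : Walk u w) → OnWalk x walk → x ≢ u → x ≢ w →
                      2 ≤ walkLength walk
  interior⇒2≤length _ onHere x≢u _ = contradiction refl x≢u
  interior⇒2≤length (step _ here) (onStep onHere) _ x≢w = contradiction refl x≢w
  interior⇒2≤length (step _ (step _ _)) (onStep _) _ _ = s≤s (s≤s z≤n)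

  interior⇒adjacent : ∀ {u w x} (walk : Walk u w) → walkLength walk ≤ 2 → OnWalk x walk →
                      x ≢ u → x ≢ w → Adj u x
  interior⇒adjacent _ _ onHere x≢u _ = contradiction refl x≢u
  interior⇒adjacent (step _ here) _ (onStep onHere) _ x≢w = contradiction refl x≢w
  interior⇒adjacent (step u~x (step _ here)) _ (onStep onHere) _ _ = u~x
  interior⇒adjacent (step _ (step _ here)) _ (onStep (onStep onHere)) _ x≢w = contradiction refl x≢w
  interior⇒adjacent (step _ (step _ (step _ _))) (s≤s (s≤s ())) _ _ _

  geodesic-interior : ∀ {u w x} (walk : Walk u w) → Shortest walk → OnWalk x walk → x ≢ u → x ≢ w →
                      Twins u w × Adj u x
  geodesic-interior {u} {w} walk shortest x∈walk x≢u x≢w with p u ≟ p w | u ≟ w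
  ... | no u~w | _ =
    contradiction (≤-trans (interior⇒2≤length walk x∈walk x≢u x≢w) (shortest (step u~w here)))
                  λ { (s≤s ()) }
  ... | yes _ | yes refl =
    contradiction (≤-trans (interior⇒2≤length walk x∈walk x≢u x≢w) (shortest here)) λ ()
  ... | yes pu≡pw | no u≢w =
    let _ , u~y = first-neighbour u≢w walk in
    (u≢w , pu≡pw) , interior⇒adjacent walk (shortest (detour u~y pu≡pw)) x∈walk x≢u x≢w

  between-twins : ∀ {S u w x} → Convex S → Twins u w → Adj u x → u ∈ S → w ∈ S → x ∈ S
  between-twins convex twins@(_ , pu≡pw) u~x u∈S w∈S =
    convex _ _ u∈S w∈S (detour u~x pu≡pw) (twins-distance twins) _ (onStep onHere)

  Between : Fin n → Set
  Between x = ∃₂ λ u w → Twins u w × Adj u x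

  between? : ∀ x → Dec (Between x)
  between? x = any? λ u → any? λ w → (¬? (u ≟ w) ×-dec p u ≟ p w) ×-dec ¬? (p u ≟ p x)

  required : Subset n
  required = tabulate (λ x → does (¬? (between? x)))

  ∈required⇒¬between : ∀ {x} → x ∈ required → ¬ Between x
  ∈required⇒¬between {x} x∈R with between? x | ∈-tabulate⁻ _ x∈R
  ... | no ¬between | _ = ¬between

  ¬between⇒∈required : ∀ {x} → ¬ Between x → x ∈ required
  ¬between⇒∈required {x} ¬between = ∈-tabulate⁺ _ (dec-true (¬? (between? x)) ¬between)

  required-extreme : ∀ {x} → x ∈ required → Convex (∁ ⁅ x ⁆)
  required-extreme {x} x∈R u w u∈S w∈S walk shortest y y∈walk with y ≟ x
  ... | no y≢x = x∉p⇒x∈∁p (y≢x ∘ x∈⁅y⁆⇒x≡y x)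
  ... | yes refl =
    let twins , u~x = geodesic-interior walk shortest y∈walk (avoid u∈S) (avoid w∈S) in
    contradiction (u , w , twins , u~x) (∈required⇒¬between x∈R)
    where
    avoid : ∀ {v} → v ∈ ∁ ⁅ y ⁆ → y ≢ v
    avoid v∈S = ≢-sym (x∉⁅y⁆⇒x≢y (x∈∁p⇒x∉p v∈S))

  generating⇒required⊆ : ∀ {P} → Generating P → required ⊆ P
  generating⇒required⊆ {P} generating {x} x∈R with x ∈? P
  ... | yes x∈P = x∈P
  ... | no x∉P =
    contradiction (x∈⁅x⁆ x) (x∈∁p⇒x∉p (generating (∁ ⁅ x ⁆) P⊆S (required-extreme x∈R) x))
    where
    P⊆S : P ⊆ ∁ ⁅ x ⁆
    P⊆S y∈P = x∉p⇒x∈∁p λ y∈⁅x⁆ → x∉P (subst (_∈ P) (x∈⁅y⁆⇒x≡y x y∈⁅x⁆) y∈P)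

  mutual
    twins⇒2≤partSize : ∀ {i u w} → u ≢ w → p u ≡ i → p w ≡ i → 2 ≤ partSize i
    twins⇒2≤partSize u≢w pu≡i pw≡i =
      2≤∣p∣ (∈-tabulate⁺ _ (in-part pu≡i)) (∈-tabulate⁺ _ (in-part pw≡i)) u≢w

    -- The Boolean function tabulated by partSize is local to its where-block and cannot
    -- be named here, so the type of this lemma is inferred from its use above.
    in-part : ∀ {i v} → p v ≡ i → _
    in-part {i} {v} pv≡i with p v ≟ i
    ... | yes _ = refl
    ... | no pv≢i = contradiction pv≡i pv≢i

  twins-same-part : lam ≤ 1 → ∀ {u w u′ w′} → Twins u w → Twins u′ w′ → p u ≡ p u′
  twins-same-part lam≤1 {u} {u′ = u′} (u≢w , pu≡pw) (u′≢w′ , pu′≡pw′) with p u ≟ p u′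
  ... | yes pu≡pu′ = pu≡pu′
  ... | no pu≢pu′ =
    contradiction (≤-trans (2≤length (big u≢w pu≡pw) (big u′≢w′ pu′≡pw′) pu≢pu′) lam≤1)
                  λ { (s≤s ()) }
    where
    big : ∀ {u w} → u ≢ w → p u ≡ p w → p u ∈ˡ filter (λ i → 2 ≤? partSize i) (allFinL k)
    big u≢w pu≡pw =
      ∈-filter⁺ (λ i → 2 ≤? partSize i) (∈-allFin _) (twins⇒2≤partSize u≢w refl (sym pu≡pw))

  twin-required : lam ≤ 1 → ∀ {u w} → Twins u w → u ∈ required
  twin-required lam≤1 twins = ¬between⇒∈required λ (_ , _ , twins′ , u′~u) →
    u′~u (twins-same-part lam≤1 twins′ twins)

  required⊆⇒generating : lam ≤ 1 → ∀ {P} → required ⊆ P → Generating P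
  required⊆⇒generating lam≤1 R⊆P S P⊆S convex x with between? x
  ... | yes (_ , _ , twins , u~x) =
    between-twins convex twins u~x (P⊆S (R⊆P (twin-required lam≤1 twins)))
                                   (P⊆S (R⊆P (twin-required lam≤1 (twins-sym twins))))
  ... | no ¬between = P⊆S (R⊆P (¬between⇒∈required ¬between))

  two-required : lam ≤ 1 → (∀ i → ∃ λ v → p v ≡ i) → ∀ {i₀ i₁} → i₀ ≢ i₁ → 2 ≤ ∣ required ∣
  two-required lam≤1 onto {i₀} {i₁} i₀≢i₁ with any? (λ u → any? λ w → ¬? (u ≟ w) ×-dec p u ≟ p w)
  ... | yes (_ , _ , twins) =
    2≤∣p∣ (twin-required lam≤1 twins) (twin-required lam≤1 (twins-sym twins)) (proj₁ twins)
  ... | no no-twins =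
    let v₀ , pv₀≡i₀ = onto i₀; v₁ , pv₁≡i₁ = onto i₁ in
    2≤∣p∣ (all-required v₀) (all-required v₁)
          λ v₀≡v₁ → i₀≢i₁ (trans (sym pv₀≡i₀) (trans (cong p v₀≡v₁) pv₁≡i₁))
    where
    all-required : ∀ x → x ∈ required
    all-required x = ¬between⇒∈required λ (u , w , twins , _) → no-twins (u , w , twins)

proposition7p16 : (n k : ℕ) (p : Fin n → Fin k) →
    2 ≤ k →
    (∀ i → ∃ λ v → p v ≡ i) →
    (∀ i j → i ≤ᶠ j → CMG.partSize p i ≤ CMG.partSize p j) →
    CMG.lam p ≤ 1 →
    NimIs (CMG.MoveDNG p) n ⊥ (1 ∸ n % 2) × NimIs (CMG.MoveGEN p) n ⊥ (n % 2)
proposition7p16 n (suc zero) p (s≤s ()) _ _ _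
proposition7p16 n (suc (suc k)) p _ onto _ lam≤1 =
  subst (λ m → NimIs MoveDNG m ⊥ (1 ∸ m % 2) × NimIs MoveGEN m ⊥ (m % 2))
        (∣p∣+∣∁p∣≡n {p = required})
    (nim-values initial-counts (two-required lam≤1 onto {fzero} {fsuc fzero} λ ()))
  where
  open CompleteMultipartite p
  open TargetGame (CMG.Generating p) required (required⊆⇒generating lam≤1) generating⇒required⊆

  initial-counts : Counts ⊥ ∣ required ∣ ∣ ∁ required ∣
  initial-counts = cong ∣_∣ (p─⊥≡p required) , cong ∣_∣ (p─⊥≡p (∁ required))
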